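{- Let $H=(V,E)$ be a $k$-uniform hypergraph and $U\subseteq V$ such that $|e\cap U|\le 2$ for all $e\in E$. Let $f(e)=2$ if $|e\cap U|=2$ and $f(e)=1$ otherwise, and let $X\subseteq V\setminus U$. Then, over the polynomial ring over $\mathrm{GF}(2^m)$ in the variables $\{v_e\}_{e\in E}$, $$W_{2,f}(H,U,X)=\sum_{i=0}^{|U|}Z\!\left(\frac{|V|}{k}-\left\lfloor\frac{|U|+i}{2}\right\rfloor\right)M_i,$$ where $M_i=\sum_{M\in\mathcal{M}_i}\prod_{e\in M}v_e^{p(e)}$, with $\mathcal{M}_i$ the set of perfect matchings containing exactly $i$ loops in the projected hypergraph on $U$ of $H$ restricted to the edges disjoint from $X$, $p(e)=1$ if $e$ is a loop and $p(e)=2$ otherwise; and $Z(j)=\sum_{E'\subseteq Z,\,|E'|=j}\prod_{e'\in E'}v_{e'}$, where $Z$ is the set of edges $e\in E$ with $e\cap X=\emptyset$ and $e\cap U=\emptyset$.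
   Context: A hypergraph $H=(V,E)$ has vertex set $V$ and a multiset $E$ of edges (subsets of $V$); $k$-uniform means every edge has $k$ vertices. Each edge $e$ (each occurrence) has its own variable $v_e$. For $U\subseteq V$ the projected hypergraph has one edge $e\cap U$ per $e\in E$; a projected edge $e\cap U=\{i\}$ is a loop covering $i$, and $e\cap U=\{i,j\}$ covers $i,j$. A perfect matching is a set $M$ of edges with nonempty projections such that each vertex of $U$ is covered by exactly one $e\cap U$, $e\in M$. Also $W_{2,f}(H,U,X)=\sum_{E''}\prod_{e\in E''}v_e^{f(e)}$, the sum over all $E''\subseteq E$ with $e\cap X=\emptyset$ for all $e\in E''$, $|E''|=|V|/k$, $U\subseteq\bigcup_{e\in E''}e$, and $e_1\cap e_2\cap U=\emptyset$ for all distinct $e_1,e_2\in E''$. An empty sum (e.g. $Z(j)$ for $j<0$ or $j>|Z|$) is zero. -}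

module Defs where

open import Level using (Level)
open import Data.Bool using (Bool; true; false; _∧_; _∨_; not; if_then_else_)
open import Data.Nat using (ℕ; zero; suc; _∸_) renaming (_+_ to _+ℕ_)
open import Data.Nat using ( _≡ᵇ_; _≤ᵇ_; _/_; NonZero)
open import Data.Fin using (Fin; zero; suc) renaming (_≟_ to _≟ᶠ_)
open import Data.Fin.Subset using (Subset; _∩_; _∪_; ∣_∣; ⊥)
open import Data.Vec using (Vec; []; _∷_; lookup; tabulate)
open import Data.List using (List; []; _∷_; map; _++_; allFin; upTo; foldr)
import Data.List.Base as L
open import Relation.Nullary using (does)
open import Algebra.Bundles using (CommutativeRing)

allSubsets : (m : ℕ) → List (Subset m)
allSubsets zero = [] ∷ []
allSubsets (suc m) = map (true ∷_) (allSubsets m) ++ map (false ∷_) (allSubsets m)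

allB : {m : ℕ} → (Fin m → Bool) → Bool
allB {m} P = foldr (λ i acc → P i ∧ acc) true (allFin m)

_∈ᵇ_ : {n : ℕ} → Fin n → Subset n → Bool
i ∈ᵇ S = lookup S i

_⊆ᵇ_ : {n : ℕ} → Subset n → Subset n → Bool
A ⊆ᵇ B = allB (λ u → not (u ∈ᵇ A) ∨ (u ∈ᵇ B))

-- Combinatorial data of a hypergraph H = (V, E) with V = Fin n and
-- a multiset of m edges given as an indexed family E : Fin m → Subset n,
-- together with U, X ⊆ V.
module Hyper {n m : ℕ} (E : Fin m → Subset n) (U X : Subset n) where

  proj : Fin m → Subset n
  proj e = E e ∩ U

  disjX : Fin m → Bool
  disjX e = ∣ E e ∩ X ∣ ≡ᵇ 0

  isLoop : Fin m → Bool
  isLoop e = ∣ proj e ∣ ≡ᵇ 1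

  f : Fin m → ℕ
  f e = if ∣ proj e ∣ ≡ᵇ 2 then 2 else 1

  p : Fin m → ℕ
  p e = if isLoop e then 1 else 2

  unionOf : Subset m → Subset n
  unionOf S = foldr (λ e acc → if e ∈ᵇ S then E e ∪ acc else acc) ⊥ (allFin m)

  -- index condition of W_{2,f}(H,U,X), with |V|/k = n / k
  isWSet : (k : ℕ) .{{_ : NonZero k}} → Subset m → Bool
  isWSet k S =
    allB (λ e → not (e ∈ᵇ S) ∨ disjX e)
    ∧ (∣ S ∣ ≡ᵇ n / k)
    ∧ (U ⊆ᵇ unionOf S)
    ∧ allB (λ e₁ → allB (λ e₂ →
         not (e₁ ∈ᵇ S ∧ e₂ ∈ᵇ S ∧ not (does (e₁ ≟ᶠ e₂)))
         ∨ (∣ E e₁ ∩ E e₂ ∩ U ∣ ≡ᵇ 0)))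

  coverCount : Subset m → Fin n → ℕ
  coverCount M u = ∣ tabulate (λ e → e ∈ᵇ M ∧ (u ∈ᵇ proj e)) ∣

  isPM : Subset m → Bool
  isPM M =
    allB (λ e → not (e ∈ᵇ M) ∨ (disjX e ∧ not (∣ proj e ∣ ≡ᵇ 0)))
    ∧ allB (λ u → not (u ∈ᵇ U) ∨ (coverCount M u ≡ᵇ 1))

  loops : Subset m → ℕ
  loops M = ∣ tabulate (λ e → e ∈ᵇ M ∧ isLoop e) ∣

  inZ : Fin m → Bool
  inZ e = disjX e ∧ (∣ proj e ∣ ≡ᵇ 0)

  module Poly {c ℓ : Level} (R : CommutativeRing c ℓ) (v : Fin m → CommutativeRing.Carrier R) where
    open CommutativeRing R

    sumL : {A : Set} → List A → (A → Carrier) → Carrier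
    sumL xs g = foldr (λ x acc → g x + acc) 0# xs

    sumSubsets : (Subset m → Bool) → (Subset m → Carrier) → Carrier
    sumSubsets P g = sumL (allSubsets m) (λ S → if P S then g S else 0#)

    prodOn : Subset m → (Fin m → Carrier) → Carrier
    prodOn S g = foldr (λ e acc → if e ∈ᵇ S then g e * acc else acc) 1# (allFin m)

    pow : Carrier → ℕ → Carrier
    pow x zero = 1#
    pow x (suc j) = x * pow x j

    W2f : (k : ℕ) .{{_ : NonZero k}} → Carrier
    W2f k = sumSubsets (isWSet k) (λ S → prodOn S (λ e → pow (v e) (f e)))

    Mpoly : ℕ → Carrier
    Mpoly i = sumSubsets (λ M → isPM M ∧ (loops M ≡ᵇ i)) (λ M → prodOn M (λ e → pow (v e) (p e)))

    Zpoly : ℕ → Carrier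
    Zpoly j = sumSubsets (λ S → allB (λ e → not (e ∈ᵇ S) ∨ inZ e) ∧ (∣ S ∣ ≡ᵇ j)) (λ S → prodOn S v)

    -- Z(|V|/k - ⌊(|U|+i)/2⌋), zero when the argument is negative
    Zterm : (k : ℕ) .{{_ : NonZero k}} → ℕ → Carrier
    Zterm k i = if ((∣ U ∣ +ℕ i) / 2) ≤ᵇ (n / k) then Zpoly (n / k ∸ ((∣ U ∣ +ℕ i) / 2)) else 0#

    RHS : (k : ℕ) .{{_ : NonZero k}} → Carrier
    RHS k = sumL (upTo (suc ∣ U ∣)) (λ i → Zterm k i * Mpoly i)

module Submission where

-- Both sides are sums of monomials indexed by sets of edges.  Split every
-- edge set S on the left as A ∪ B, where A are the edges of S meeting U
-- and B the others ('sum-separated').  The key combinatorial fact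
-- ('decomposition') is that S = A ∪ B is an index set of W_{2,f} iff A is
-- a perfect matching of the projected hypergraph on U, B ⊆ Z, and
-- |B| = |V|/k − |A|.  By the handshake lemma |U| + loops(A) = 2|A|
-- ('handshake'), so |A| = ⌊(|U|+i)/2⌋ with i = loops(A): the pair (A , B)
-- is exactly an index of the i-th term Z(·) M_i on the right, and only for
-- this i ('term-collapse').  Finally the monomials agree, because the
-- exponent f(e) equals p(e) on edges meeting U and is 1 on Z ('weight').

open import Defs
open import Level using (Level)
open import Data.Bool using (Bool; true; false; _∧_; _∨_; not; if_then_else_)
open import Data.Bool.Properties using (∧-zeroʳ; ¬-not; T-≡)
open import Data.Nat using (ℕ; zero; suc; _∸_; _≤_; _<_; z≤n; s≤s; _≡ᵇ_; _≤ᵇ_; _<ᵇ_; _/_; NonZero)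
import Data.Nat.Properties as ℕ
open import Data.Nat using () renaming (_+_ to _+ℕ_)
open import Data.Nat.DivMod using (m*n/n≡m)
open import Data.Fin using (Fin; zero; suc) renaming (_≟_ to _≟ᶠ_)
open import Data.Fin.Properties using (suc-injective; 0≢1+n)
open import Data.Fin.Subset using (Subset; _∩_; _∪_; _⊆_; ∁; ∣_∣)
import Data.Fin.Subset as Sub
open import Data.Vec using (Vec; []; _∷_; lookup; tabulate)
open import Data.Vec.Properties using (lookup-zipWith; lookup-replicate; lookup∘tabulate)
open import Data.List using (List; []; _∷_; map; _++_; foldr; upTo; applyUpTo)
import Data.List as List
open import Data.Product using (∃; _×_; _,_)
open import Data.Sum using (_⊎_; inj₁; inj₂)
open import Data.Empty using (⊥-elim) renaming (⊥ to Empty)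
open import Relation.Nullary using (does; yes; no)
open import Relation.Binary.PropositionalEquality using (_≡_; _≢_; refl; sym; trans; cong; cong₂; subst; module ≡-Reasoning)
open import Algebra.Bundles using (CommutativeRing)
open import Algebra.Properties.CommutativeMonoid.Sum ℕ.+-0-commutativeMonoid using (sum-syntax; ∑-comm; ∑-distrib-+; sum-cong-≗; sum-replicate-zero)
open import Function using (_∘_; id)
open import Function.Bundles using (Equivalence)

∧-elimˡ : ∀ {a b} → a ∧ b ≡ true → a ≡ true
∧-elimˡ {true} _ = refl

∧-elimʳ : ∀ {a b} → a ∧ b ≡ true → b ≡ true
∧-elimʳ {true} h = h

∧-elim : ∀ {a b} → a ∧ b ≡ true → a ≡ true × b ≡ true
∧-elim {true} h = refl , h

∧-intro : ∀ {a b} → a ≡ true → b ≡ true → a ∧ b ≡ true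
∧-intro refl refl = refl

∨-elim : ∀ {a b} → a ∨ b ≡ true → a ≡ true ⊎ b ≡ true
∨-elim {true} _ = inj₁ refl
∨-elim {false} h = inj₂ h

∨-introˡ : ∀ {a b} → a ≡ true → a ∨ b ≡ true
∨-introˡ refl = refl

∨-introʳ : ∀ {a b} → b ≡ true → a ∨ b ≡ true
∨-introʳ {true} _ = refl
∨-introʳ {false} h = h

⇒-elim : ∀ {a b} → not a ∨ b ≡ true → a ≡ true → b ≡ true
⇒-elim {true} h refl = h

⇒-intro : ∀ {a b} → (a ≡ true → b ≡ true) → not a ∨ b ≡ true
⇒-intro {true} h = h refl
⇒-intro {false} _ = refl

true≢false : ∀ {b} → b ≡ true → b ≢ false
true≢false refl ()

bool-ext : ∀ {a b} → (a ≡ true → b ≡ true) → (b ≡ true → a ≡ true) → a ≡ b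
bool-ext {true} a⇒b _ = sym (a⇒b refl)
bool-ext {false} {true} _ b⇒a = b⇒a refl
bool-ext {false} {false} _ _ = refl

≡ᵇ-sound : ∀ {x y} → (x ≡ᵇ y) ≡ true → x ≡ y
≡ᵇ-sound {x} {y} h = ℕ.≡ᵇ⇒≡ x y (Equivalence.from T-≡ h)

≡ᵇ-complete : ∀ {x y} → x ≡ y → (x ≡ᵇ y) ≡ true
≡ᵇ-complete {zero} refl = refl
≡ᵇ-complete {suc x} refl = ≡ᵇ-complete {x} refl

≡ᵇ-false : ∀ {x y} → x ≢ y → (x ≡ᵇ y) ≡ false
≡ᵇ-false ne = ¬-not (λ t → ne (≡ᵇ-sound t))

≤ᵇ-sound : ∀ {x y} → (x ≤ᵇ y) ≡ true → x ≤ y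
≤ᵇ-sound {x} {y} h = ℕ.≤ᵇ⇒≤ x y (Equivalence.from T-≡ h)

≤ᵇ-complete : ∀ {x y} → x ≤ y → (x ≤ᵇ y) ≡ true
≤ᵇ-complete le = Equivalence.to T-≡ (ℕ.≤⇒≤ᵇ le)

<ᵇ-complete : ∀ {x y} → x < y → (x <ᵇ y) ≡ true
<ᵇ-complete lt = Equivalence.to T-≡ (ℕ.<⇒<ᵇ lt)

nonzeroᵇ-sound : ∀ x → not (x ≡ᵇ 0) ≡ true → x ≢ 0
nonzeroᵇ-sound zero () refl

nonzeroᵇ-complete : ∀ x → x ≢ 0 → not (x ≡ᵇ 0) ≡ true
nonzeroᵇ-complete zero h = ⊥-elim (h refl)
nonzeroᵇ-complete (suc x) _ = refl

-- allB P holds iff P holds everywhere; proved for the fold over an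
-- arbitrary enumeration f, of which allFin is the case f = id.
module _ {m : ℕ} (P : Fin m → Bool) where

  allOn : ∀ {m'} → (Fin m' → Fin m) → Bool
  allOn f = foldr (λ i acc → P i ∧ acc) true (List.tabulate f)

  allOn-sound : ∀ {m'} (f : Fin m' → Fin m) → allOn f ≡ true → ∀ j → P (f j) ≡ true
  allOn-sound f h zero = ∧-elimˡ h
  allOn-sound f h (suc j) = allOn-sound (f ∘ suc) (∧-elimʳ {P (f zero)} h) j

  allOn-complete : ∀ {m'} (f : Fin m' → Fin m) → (∀ j → P (f j) ≡ true) → allOn f ≡ true
  allOn-complete {zero} f h = refl
  allOn-complete {suc m'} f h = ∧-intro (h zero) (allOn-complete (f ∘ suc) (h ∘ suc))

  allB-sound : allB P ≡ true → ∀ i → P i ≡ true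
  allB-sound = allOn-sound id

  allB-complete : (∀ i → P i ≡ true) → allB P ≡ true
  allB-complete = allOn-complete id

-- Counting the elements of a Boolean predicate on Fin m as a sum of
-- indicators, so that double counting becomes an exchange of sums.

𝟙 : Bool → ℕ
𝟙 true = 1
𝟙 false = 0

count : ∀ {m} → (Fin m → Bool) → ℕ
count {m} g = ∑[ i < m ] 𝟙 (g i)

∣tabulate∣≡count : ∀ {m} (g : Fin m → Bool) → ∣ tabulate g ∣ ≡ count g
∣tabulate∣≡count {zero} g = refl
∣tabulate∣≡count {suc m} g with g zero
... | true = cong suc (∣tabulate∣≡count (g ∘ suc))
... | false = ∣tabulate∣≡count (g ∘ suc)

∣p∣≡count : ∀ {m} (p : Subset m) → ∣ p ∣ ≡ count (lookup p)
∣p∣≡count [] = refl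
∣p∣≡count (true ∷ p) = cong suc (∣p∣≡count p)
∣p∣≡count (false ∷ p) = ∣p∣≡count p

count≡0⇒false : ∀ {m} (g : Fin m → Bool) → count g ≡ 0 → ∀ i → g i ≡ false
count≡0⇒false {suc m} g h i with g zero in g0
count≡0⇒false {suc m} g h zero | false = g0
count≡0⇒false {suc m} g h (suc i) | false = count≡0⇒false (g ∘ suc) h i

false⇒count≡0 : ∀ {m} (g : Fin m → Bool) → (∀ i → g i ≡ false) → count g ≡ 0
false⇒count≡0 {m} g h = trans (sum-cong-≗ (cong 𝟙 ∘ h)) (sum-replicate-zero m)

count≢0⇒witness : ∀ {m} (g : Fin m → Bool) → count g ≢ 0 → ∃ λ i → g i ≡ true
count≢0⇒witness {zero} g h = ⊥-elim (h refl)
count≢0⇒witness {suc m} g h with g zero in g0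
... | true = zero , g0
... | false with count≢0⇒witness (g ∘ suc) h
... | i , gi = suc i , gi

witness⇒1≤count : ∀ {m} (g : Fin m → Bool) i → g i ≡ true → 1 ≤ count g
witness⇒1≤count g zero gi rewrite gi = s≤s z≤n
witness⇒1≤count g (suc i) gi = ℕ.≤-trans (witness⇒1≤count (g ∘ suc) i gi) (ℕ.m≤n+m _ (𝟙 (g zero)))

witnesses⇒2≤count : ∀ {m} (g : Fin m → Bool) i j → i ≢ j → g i ≡ true → g j ≡ true → 2 ≤ count g
witnesses⇒2≤count g zero zero i≢j _ _ = ⊥-elim (i≢j refl)
witnesses⇒2≤count g zero (suc j) _ gi gj rewrite gi = s≤s (witness⇒1≤count (g ∘ suc) j gj)
witnesses⇒2≤count g (suc i) zero _ gi gj rewrite gj = s≤s (witness⇒1≤count (g ∘ suc) i gi)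
witnesses⇒2≤count g (suc i) (suc j) i≢j gi gj =
  ℕ.≤-trans (witnesses⇒2≤count (g ∘ suc) i j (i≢j ∘ cong suc) gi gj) (ℕ.m≤n+m _ (𝟙 (g zero)))

unique⇒count≤1 : ∀ {m} (g : Fin m → Bool) → (∀ i j → g i ≡ true → g j ≡ true → i ≡ j) → count g ≤ 1
unique⇒count≤1 {zero} g _ = z≤n
unique⇒count≤1 {suc m} g uniq with g zero in g0
... | true = ℕ.≤-reflexive (cong suc (false⇒count≡0 (g ∘ suc) noOther))
  where
  noOther : ∀ i → g (suc i) ≡ false
  noOther i = ¬-not (λ gi → 0≢1+n (uniq zero (suc i) g0 gi))
... | false = unique⇒count≤1 (g ∘ suc) (λ i j gi gj → suc-injective (uniq (suc i) (suc j) gi gj))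

count-mono : ∀ {m} (g h : Fin m → Bool) → (∀ i → g i ≡ true → h i ≡ true) → count g ≤ count h
count-mono {zero} g h _ = z≤n
count-mono {suc m} g h g⇒h with g zero in g0 | h zero in h0
... | true | true = s≤s (count-mono (g ∘ suc) (h ∘ suc) (g⇒h ∘ suc))
... | true | false = ⊥-elim (true≢false (g⇒h zero g0) h0)
... | false | true = ℕ.m≤n⇒m≤1+n (count-mono (g ∘ suc) (h ∘ suc) (g⇒h ∘ suc))
... | false | false = count-mono (g ∘ suc) (h ∘ suc) (g⇒h ∘ suc)

∣p∪q∣≡∣p∣+∣q∣ : ∀ {m} (p q : Subset m) → (∀ i → lookup p i ≡ true → lookup q i ≢ true) → ∣ p ∪ q ∣ ≡ ∣ p ∣ +ℕ ∣ q ∣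
∣p∪q∣≡∣p∣+∣q∣ [] [] _ = refl
∣p∪q∣≡∣p∣+∣q∣ (true ∷ p) (true ∷ q) d = ⊥-elim (d zero refl refl)
∣p∪q∣≡∣p∣+∣q∣ (true ∷ p) (false ∷ q) d = cong suc (∣p∪q∣≡∣p∣+∣q∣ p q (d ∘ suc))
∣p∪q∣≡∣p∣+∣q∣ (false ∷ p) (true ∷ q) d = trans (cong suc (∣p∪q∣≡∣p∣+∣q∣ p q (d ∘ suc))) (sym (ℕ.+-suc _ _))
∣p∪q∣≡∣p∣+∣q∣ (false ∷ p) (false ∷ q) d = ∣p∪q∣≡∣p∣+∣q∣ p q (d ∘ suc)

lookup-∪ : ∀ {m} (p q : Subset m) i → lookup (p ∪ q) i ≡ lookup p i ∨ lookup q i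
lookup-∪ p q i = lookup-zipWith _∨_ i p q

lookup-∩ : ∀ {m} (p q : Subset m) i → lookup (p ∩ q) i ≡ lookup p i ∧ lookup q i
lookup-∩ p q i = lookup-zipWith _∧_ i p q

∪-introˡ : ∀ {m} (p q : Subset m) i → lookup p i ≡ true → lookup (p ∪ q) i ≡ true
∪-introˡ p q i h = trans (lookup-∪ p q i) (∨-introˡ h)

∪-introʳ : ∀ {m} (p q : Subset m) i → lookup q i ≡ true → lookup (p ∪ q) i ≡ true
∪-introʳ p q i h = trans (lookup-∪ p q i) (∨-introʳ h)

∪-elim : ∀ {m} (p q : Subset m) i → lookup (p ∪ q) i ≡ true → lookup p i ≡ true ⊎ lookup q i ≡ true
∪-elim p q i h = ∨-elim (trans (sym (lookup-∪ p q i)) h)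

-- Hyper.unionOf S is ⋃_{e ∈ S} E e, folded over allFin; we prove its
-- membership property for a fold over an arbitrary enumeration f.
module _ {m n : ℕ} (E : Fin m → Subset n) (S : Subset m) where

  unionAlong : ∀ {m'} → (Fin m' → Fin m) → Subset n
  unionAlong f = foldr (λ e acc → if lookup S e then E e ∪ acc else acc) Sub.⊥ (List.tabulate f)

  unionAlong-intro : ∀ {m'} (f : Fin m' → Fin m) j u →
    lookup S (f j) ≡ true → lookup (E (f j)) u ≡ true → lookup (unionAlong f) u ≡ true
  unionAlong-intro f zero u s∋ e∋ rewrite s∋ = ∪-introˡ (E (f zero)) _ u e∋
  unionAlong-intro f (suc j) u s∋ e∋ with lookup S (f zero)
  ... | true = ∪-introʳ (E (f zero)) _ u (unionAlong-intro (f ∘ suc) j u s∋ e∋)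
  ... | false = unionAlong-intro (f ∘ suc) j u s∋ e∋

  unionAlong-elim : ∀ {m'} (f : Fin m' → Fin m) u →
    lookup (unionAlong f) u ≡ true → ∃ λ j → lookup S (f j) ≡ true × lookup (E (f j)) u ≡ true
  unionAlong-elim {zero} f u h = ⊥-elim (true≢false h (lookup-replicate u false))
  unionAlong-elim {suc m'} f u h with lookup S (f zero) in s∋
  ... | false with unionAlong-elim (f ∘ suc) u h
  ...   | j , p = suc j , p
  unionAlong-elim {suc m'} f u h | true with ∪-elim (E (f zero)) _ u h
  ...   | inj₁ e∋ = zero , s∋ , e∋
  ...   | inj₂ rest with unionAlong-elim (f ∘ suc) u rest
  ...     | j , p = suc j , p

-- 'separates N A B' says that A ⊆ N and B ⊆ ∁ N.  Summing over such
-- pairs (A , B) is the same as summing over all subsets A ∪ B.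
separates : ∀ {m} → Vec Bool m → Subset m → Subset m → Bool
separates [] [] [] = true
separates (t ∷ N) (a ∷ A) (b ∷ B) = (if t then not b else not a) ∧ separates N A B

separates-inside : ∀ {m} (N A B : Subset m) → separates N A B ≡ true → ∀ e → lookup A e ≡ true → lookup N e ≡ true
separates-inside (true ∷ N) (a ∷ A) (b ∷ B) _ zero _ = refl
separates-inside (false ∷ N) (true ∷ A) (b ∷ B) () zero _
separates-inside (false ∷ N) (false ∷ A) (b ∷ B) _ zero ()
separates-inside (t ∷ N) (a ∷ A) (b ∷ B) h (suc e) a∋ = separates-inside N A B (∧-elimʳ {if t then not b else not a} h) e a∋

separates-outside : ∀ {m} (N A B : Subset m) → separates N A B ≡ true → ∀ e → lookup B e ≡ true → lookup N e ≡ false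
separates-outside (false ∷ N) (a ∷ A) (b ∷ B) _ zero _ = refl
separates-outside (true ∷ N) (a ∷ A) (true ∷ B) () zero _
separates-outside (true ∷ N) (a ∷ A) (false ∷ B) _ zero ()
separates-outside (t ∷ N) (a ∷ A) (b ∷ B) h (suc e) b∋ = separates-outside N A B (∧-elimʳ {if t then not b else not a} h) e b∋

separates-complete : ∀ {m} (N A B : Subset m) → (∀ e → lookup A e ≡ true → lookup N e ≡ true) →
  (∀ e → lookup B e ≡ true → lookup N e ≡ false) → separates N A B ≡ true
separates-complete [] [] [] _ _ = refl
separates-complete (t ∷ N) (a ∷ A) (b ∷ B) inside outside =
  ∧-intro (head t a b (inside zero) (outside zero)) (separates-complete N A B (inside ∘ suc) (outside ∘ suc))
  where
  head : ∀ t a b → (a ≡ true → t ≡ true) → (b ≡ true → t ≡ false) → (if t then not b else not a) ≡ true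
  head true a false _ _ = refl
  head true a true _ out = ⊥-elim (true≢false refl (out refl))
  head false false b _ _ = refl
  head false true b ins _ = ⊥-elim (true≢false (ins refl) refl)

-- Finite sums and products in a commutative ring.  'sumOver xs g' is
-- Σ_{x ∈ xs} g x, definitionally the sum 'sumL' used in Defs.
module RingSums {c ℓ : Level} (R : CommutativeRing c ℓ) where
  open CommutativeRing R renaming (refl to ≈-refl; sym to ≈-sym; trans to ≈-trans) hiding (zero)
  open import Relation.Binary.Reasoning.Setoid setoid

  sumOver : {A : Set} → List A → (A → Carrier) → Carrier
  sumOver xs g = foldr (λ x acc → g x + acc) 0# xs

  sumOver-cong : {A : Set} (xs : List A) {g h : A → Carrier} → (∀ x → g x ≈ h x) → sumOver xs g ≈ sumOver xs h
  sumOver-cong [] _ = ≈-refl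
  sumOver-cong (x ∷ xs) g≈h = +-cong (g≈h x) (sumOver-cong xs g≈h)

  sumOver-zero : {A : Set} (xs : List A) (g : A → Carrier) → (∀ x → g x ≈ 0#) → sumOver xs g ≈ 0#
  sumOver-zero [] _ _ = ≈-refl
  sumOver-zero (x ∷ xs) g g≈0 = ≈-trans (+-cong (g≈0 x) (sumOver-zero xs g g≈0)) (+-identityˡ 0#)

  sumOver-++ : {A : Set} (xs ys : List A) (g : A → Carrier) → sumOver (xs ++ ys) g ≈ sumOver xs g + sumOver ys g
  sumOver-++ [] ys g = ≈-sym (+-identityˡ _)
  sumOver-++ (x ∷ xs) ys g = ≈-trans (+-congˡ (sumOver-++ xs ys g)) (≈-sym (+-assoc _ _ _))

  sumOver-map : {A B : Set} (f : A → B) (xs : List A) (g : B → Carrier) → sumOver (map f xs) g ≈ sumOver xs (g ∘ f)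
  sumOver-map f [] g = ≈-refl
  sumOver-map f (x ∷ xs) g = +-congˡ (sumOver-map f xs g)

  sumOver-+ : {A : Set} (xs : List A) (g h : A → Carrier) → sumOver xs (λ x → g x + h x) ≈ sumOver xs g + sumOver xs h
  sumOver-+ [] g h = ≈-sym (+-identityˡ 0#)
  sumOver-+ (x ∷ xs) g h = begin
    (g x + h x) + sumOver xs (λ y → g y + h y) ≈⟨ +-congˡ (sumOver-+ xs g h) ⟩
    (g x + h x) + (sumOver xs g + sumOver xs h) ≈⟨ +-assoc (g x) (h x) _ ⟩
    g x + (h x + (sumOver xs g + sumOver xs h)) ≈⟨ +-congˡ (≈-sym (+-assoc (h x) _ _)) ⟩
    g x + ((h x + sumOver xs g) + sumOver xs h) ≈⟨ +-congˡ (+-congʳ (+-comm (h x) _)) ⟩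
    g x + ((sumOver xs g + h x) + sumOver xs h) ≈⟨ +-congˡ (+-assoc _ (h x) _) ⟩
    g x + (sumOver xs g + (h x + sumOver xs h)) ≈⟨ ≈-sym (+-assoc (g x) _ _) ⟩
    (g x + sumOver xs g) + (h x + sumOver xs h) ∎

  sumOver-*ˡ : {A : Set} (a : Carrier) (xs : List A) (g : A → Carrier) → a * sumOver xs g ≈ sumOver xs (λ x → a * g x)
  sumOver-*ˡ a [] g = zeroʳ a
  sumOver-*ˡ a (x ∷ xs) g = ≈-trans (distribˡ a _ _) (+-congˡ (sumOver-*ˡ a xs g))

  sumOver-*ʳ : {A : Set} (a : Carrier) (xs : List A) (g : A → Carrier) → sumOver xs g * a ≈ sumOver xs (λ x → g x * a)
  sumOver-*ʳ a [] g = zeroˡ a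
  sumOver-*ʳ a (x ∷ xs) g = ≈-trans (distribʳ a _ _) (+-congˡ (sumOver-*ʳ a xs g))

  sumOver-swap : {A B : Set} (xs : List A) (ys : List B) (g : A → B → Carrier) →
    sumOver xs (λ x → sumOver ys (g x)) ≈ sumOver ys (λ y → sumOver xs (λ x → g x y))
  sumOver-swap [] ys g = ≈-sym (sumOver-zero ys _ (λ _ → ≈-refl))
  sumOver-swap (x ∷ xs) ys g = ≈-trans (+-congˡ (sumOver-swap xs ys g)) (≈-sym (sumOver-+ ys (g x) _))

  sumOver-*-sumOver : {A B : Set} (xs : List A) (ys : List B) (g : A → Carrier) (h : B → Carrier) →
    sumOver xs g * sumOver ys h ≈ sumOver xs (λ x → sumOver ys (λ y → g x * h y))
  sumOver-*-sumOver xs ys g h = ≈-trans (sumOver-*ʳ _ xs g) (sumOver-cong xs (λ x → sumOver-*ˡ (g x) ys h))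

  sumOver-applyUpTo-zero : ∀ N (f : ℕ → ℕ) (h : ℕ → Carrier) → (∀ j → h (f j) ≈ 0#) → sumOver (applyUpTo f N) h ≈ 0#
  sumOver-applyUpTo-zero zero f h _ = ≈-refl
  sumOver-applyUpTo-zero (suc N) f h h≈0 =
    ≈-trans (+-cong (h≈0 0) (sumOver-applyUpTo-zero N (f ∘ suc) h (h≈0 ∘ suc))) (+-identityˡ 0#)

  sumOver-applyUpTo-single : ∀ N (f : ℕ → ℕ) (h : ℕ → Carrier) l → (∀ j → j ≢ l → h (f j) ≈ 0#) →
    sumOver (applyUpTo f N) h ≈ (if l <ᵇ N then h (f l) else 0#)
  sumOver-applyUpTo-single zero f h l _ = ≈-refl
  sumOver-applyUpTo-single (suc N) f h zero off =
    ≈-trans (+-congˡ (sumOver-applyUpTo-zero N (f ∘ suc) h (λ j → off (suc j) (λ ())))) (+-identityʳ _)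
  sumOver-applyUpTo-single (suc N) f h (suc l) off =
    ≈-trans (+-congʳ (off 0 (λ ()))) (≈-trans (+-identityˡ _)
      (sumOver-applyUpTo-single N (f ∘ suc) h l (λ j j≢l → off (suc j) (j≢l ∘ ℕ.suc-injective))))

  if-nest : ∀ a b (x : Carrier) → (if a then (if b then x else 0#) else 0#) ≡ (if a ∧ b then x else 0#)
  if-nest true b x = refl
  if-nest false b x = refl

  if-*-if : ∀ c z q (x y : Carrier) →
    (if c then (if z then x else 0#) else 0#) * (if q then y else 0#) ≈ (if (c ∧ z) ∧ q then x * y else 0#)
  if-*-if false z q x y = zeroˡ _
  if-*-if true false q x y = zeroˡ _
  if-*-if true true false x y = zeroʳ x
  if-*-if true true true x y = ≈-refl

  if-sumOver : {A : Set} (b : Bool) (xs : List A) (g : A → Carrier) →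
    (if b then sumOver xs g else 0#) ≈ sumOver xs (λ x → if b then g x else 0#)
  if-sumOver true xs g = ≈-refl
  if-sumOver false xs g = ≈-sym (sumOver-zero xs _ (λ _ → ≈-refl))

  -- Products of the terms along an enumeration f of edges, restricted
  -- to the members of S; Poly.prodOn is the case f = id.
  prodAlong : ∀ {m m'} (S : Subset m) (g : Fin m → Carrier) → (Fin m' → Fin m) → Carrier
  prodAlong S g f = foldr (λ e acc → if lookup S e then g e * acc else acc) 1# (List.tabulate f)

  prodAlong-cong : ∀ {m m'} (S : Subset m) (g h : Fin m → Carrier) (f : Fin m' → Fin m) →
    (∀ j → lookup S (f j) ≡ true → g (f j) ≈ h (f j)) → prodAlong S g f ≈ prodAlong S h f
  prodAlong-cong {m' = zero} S g h f _ = ≈-refl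
  prodAlong-cong {m' = suc m'} S g h f g≈h with lookup S (f zero) in s∋
  ... | true = *-cong (g≈h zero s∋) (prodAlong-cong S g h (f ∘ suc) (g≈h ∘ suc))
  ... | false = prodAlong-cong S g h (f ∘ suc) (g≈h ∘ suc)

  prodAlong-∪ : ∀ {m m'} (A B : Subset m) (g : Fin m → Carrier) (f : Fin m' → Fin m) →
    (∀ j → lookup A (f j) ≡ true → lookup B (f j) ≢ true) → prodAlong (A ∪ B) g f ≈ prodAlong A g f * prodAlong B g f
  prodAlong-∪ {m' = zero} A B g f _ = ≈-sym (*-identityˡ 1#)
  prodAlong-∪ {m' = suc m'} A B g f disj rewrite lookup-∪ A B (f zero)
    with lookup A (f zero) in a∋ | lookup B (f zero) in b∋
  ... | true | true = ⊥-elim (disj zero a∋ b∋)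
  ... | true | false = ≈-trans (*-congˡ (prodAlong-∪ A B g (f ∘ suc) (disj ∘ suc))) (≈-sym (*-assoc _ _ _))
  ... | false | true = begin
    g (f zero) * prodAlong (A ∪ B) g (f ∘ suc)             ≈⟨ *-congˡ (prodAlong-∪ A B g (f ∘ suc) (disj ∘ suc)) ⟩
    g (f zero) * (prodAlong A g (f ∘ suc) * prodAlong B g (f ∘ suc)) ≈⟨ ≈-sym (*-assoc _ _ _) ⟩
    (g (f zero) * prodAlong A g (f ∘ suc)) * prodAlong B g (f ∘ suc) ≈⟨ *-congʳ (*-comm _ _) ⟩
    (prodAlong A g (f ∘ suc) * g (f zero)) * prodAlong B g (f ∘ suc) ≈⟨ *-assoc _ _ _ ⟩
    prodAlong A g (f ∘ suc) * (g (f zero) * prodAlong B g (f ∘ suc)) ∎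
  ... | false | false = prodAlong-∪ A B g (f ∘ suc) (disj ∘ suc)

  sumSubsets-suc : ∀ {m} (h : Subset (suc m) → Carrier) →
    sumOver (allSubsets (suc m)) h ≈ sumOver (allSubsets m) (h ∘ (true ∷_)) + sumOver (allSubsets m) (h ∘ (false ∷_))
  sumSubsets-suc {m} h = ≈-trans (sumOver-++ (map (true ∷_) (allSubsets m)) _ h)
    (+-cong (sumOver-map (true ∷_) (allSubsets m) h) (sumOver-map (false ∷_) (allSubsets m) h))

  separatedSum : ∀ {m} → Vec Bool m → (Subset m → Carrier) → Carrier
  separatedSum {m} N F = sumOver (allSubsets m) (λ A → sumOver (allSubsets m) (λ B →
    if separates N A B then F (A ∪ B) else 0#))

  zeros+ : ∀ m {x} → sumOver (allSubsets m) (λ _ → 0#) + x ≈ x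
  zeros+ m = ≈-trans (+-congʳ (sumOver-zero (allSubsets m) _ (λ _ → ≈-refl))) (+-identityˡ _)

  separatedSum-suc : ∀ {m} t (N : Vec Bool m) (F : Subset (suc m) → Carrier) →
    let Σ = sumOver (allSubsets m)
        G = λ A B → if separates (t ∷ N) A B then F (A ∪ B) else 0#
    in separatedSum (t ∷ N) F ≈
      Σ (λ A → Σ (λ B → G (true ∷ A) (true ∷ B)) + Σ (λ B → G (true ∷ A) (false ∷ B)))
      + Σ (λ A → Σ (λ B → G (false ∷ A) (true ∷ B)) + Σ (λ B → G (false ∷ A) (false ∷ B)))
  separatedSum-suc {m} t N F = ≈-trans (sumSubsets-suc {m} _)
    (+-cong (sumOver-cong (allSubsets m) (λ A → sumSubsets-suc {m} _))
            (sumOver-cong (allSubsets m) (λ A → sumSubsets-suc {m} _)))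

  -- Every subset S is uniquely (S ∩ N) ∪ (S ∖ N), so summing F over all S
  -- equals summing F (A ∪ B) over the pairs separated by N.
  sum-separated : ∀ {m} (N : Vec Bool m) (F : Subset m → Carrier) →
    sumOver (allSubsets m) F ≈ separatedSum N F
  sum-separated [] F = +-congʳ (≈-sym (+-identityʳ (F [])))
  sum-separated {suc m} (true ∷ N) F = ≈-trans (sumSubsets-suc F) (≈-trans
    (+-cong (sum-separated N (F ∘ (true ∷_))) (sum-separated N (F ∘ (false ∷_))))
    (≈-sym (≈-trans (separatedSum-suc true N F)
      (+-cong (sumOver-cong (allSubsets m) (λ _ → zeros+ m)) (sumOver-cong (allSubsets m) (λ _ → zeros+ m))))))
  sum-separated {suc m} (false ∷ N) F = ≈-trans (sumSubsets-suc F) (≈-trans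
    (+-cong (sum-separated N (F ∘ (true ∷_))) (sum-separated N (F ∘ (false ∷_))))
    (≈-sym (≈-trans (separatedSum-suc false N F) (≈-trans
      (+-congʳ (sumOver-zero (allSubsets m) _ (λ _ → ≈-trans (zeros+ m) (sumOver-zero (allSubsets m) _ (λ _ → ≈-refl)))))
      (≈-trans (+-identityˡ _) (sumOver-+ (allSubsets m) _ _))))))

double/2 : ∀ a → (a +ℕ a) / 2 ≡ a
double/2 a = trans (cong (_/ 2) (trans (cong (a +ℕ_) (sym (ℕ.+-identityʳ a))) (ℕ.*-comm 2 a))) (m*n/n≡m a 2)

-- An edge meeting U in one or two vertices covers two "half-edges":
-- its vertices in U, plus one more if it is a loop.
halfEdges : ∀ x → x ≢ 0 → x ≤ 2 → x +ℕ 𝟙 (x ≡ᵇ 1) ≡ 2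
halfEdges zero x≢0 _ = ⊥-elim (x≢0 refl)
halfEdges 1 _ _ = refl
halfEdges 2 _ _ = refl
halfEdges (suc (suc (suc x))) _ (s≤s (s≤s ()))

module ProjectedHypergraph {n m : ℕ} (E : Fin m → Subset n) (U X : Subset n)
  (atMostTwo : ∀ e → ∣ E e ∩ U ∣ ≤ 2) where
  open Hyper E U X

  proj-inE : ∀ e u → u ∈ᵇ proj e ≡ true → u ∈ᵇ E e ≡ true
  proj-inE e u h = ∧-elimˡ (trans (sym (lookup-∩ (E e) U u)) h)

  proj-inU : ∀ e u → u ∈ᵇ proj e ≡ true → u ∈ᵇ U ≡ true
  proj-inU e u h = ∧-elimʳ {u ∈ᵇ E e} (trans (sym (lookup-∩ (E e) U u)) h)

  proj-intro : ∀ e u → u ∈ᵇ E e ≡ true → u ∈ᵇ U ≡ true → u ∈ᵇ proj e ≡ true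
  proj-intro e u e∋ U∋ = trans (lookup-∩ (E e) U u) (∧-intro e∋ U∋)

  proj-outsideU : ∀ e u → u ∈ᵇ U ≡ false → u ∈ᵇ proj e ≡ false
  proj-outsideU e u U∌ = trans (lookup-∩ (E e) U u) (trans (cong (u ∈ᵇ E e ∧_) U∌) (∧-zeroʳ _))

  proj-empty : ∀ e u → ∣ proj e ∣ ≡ 0 → u ∈ᵇ proj e ≡ false
  proj-empty e u h = count≡0⇒false (lookup (proj e)) (trans (sym (∣p∣≡count (proj e))) h) u

  record PerfectMatching (A : Subset m) : Set where
    field
      avoidsX : ∀ e → e ∈ᵇ A ≡ true → disjX e ≡ true
      meetsU : ∀ e → e ∈ᵇ A ≡ true → ∣ proj e ∣ ≢ 0
      coversOnce : ∀ u → u ∈ᵇ U ≡ true → coverCount A u ≡ 1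

  isPM-sound : ∀ A → isPM A ≡ true → PerfectMatching A
  isPM-sound A h = record
    { avoidsX = λ e e∈A → ∧-elimˡ (edge e e∈A)
    ; meetsU = λ e e∈A → nonzeroᵇ-sound _ (∧-elimʳ {disjX e} (edge e e∈A))
    ; coversOnce = λ u u∈U → ≡ᵇ-sound (⇒-elim (allB-sound _ (∧-elimʳ {edgesOK} h) u) u∈U)
    }
    where
    edgesOK : Bool
    edgesOK = allB (λ e → not (e ∈ᵇ A) ∨ (disjX e ∧ not (∣ proj e ∣ ≡ᵇ 0)))
    edge : ∀ e → e ∈ᵇ A ≡ true → disjX e ∧ not (∣ proj e ∣ ≡ᵇ 0) ≡ true
    edge e = ⇒-elim (allB-sound _ (∧-elimˡ h) e)

  isPM-complete : ∀ A → PerfectMatching A → isPM A ≡ true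
  isPM-complete A pm = ∧-intro
    (allB-complete _ (λ e → ⇒-intro (λ e∈A → ∧-intro (avoidsX e e∈A) (nonzeroᵇ-complete _ (meetsU e e∈A)))))
    (allB-complete _ (λ u → ⇒-intro (λ u∈U → ≡ᵇ-complete (coversOnce u u∈U))))
    where open PerfectMatching pm

  covers : Subset m → Fin m → Fin n → Bool
  covers A e u = e ∈ᵇ A ∧ u ∈ᵇ proj e

  -- Handshake lemma for perfect matchings: counting the pairs (e, u)
  -- with e ∈ A covering u by vertices and by edges gives
  -- |U| + loops(A) = 2 |A|, as each edge covers one or two vertices.
  module _ {A : Subset m} (pm : PerfectMatching A) where
    open PerfectMatching pm

    tallyAtVertex : ∀ u → count (λ e → covers A e u) ≡ 𝟙 (u ∈ᵇ U)
    tallyAtVertex u with u ∈ᵇ U in U∋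
    ... | true = trans (sym (∣tabulate∣≡count (λ e → covers A e u))) (coversOnce u U∋)
    ... | false = false⇒count≡0 _ (λ e → trans (cong (e ∈ᵇ A ∧_) (proj-outsideU e u U∋)) (∧-zeroʳ _))

    tallyAtEdge : ∀ e → count (covers A e) +ℕ 𝟙 (e ∈ᵇ A ∧ isLoop e) ≡ 𝟙 (e ∈ᵇ A) +ℕ 𝟙 (e ∈ᵇ A)
    tallyAtEdge e with e ∈ᵇ A in A∋
    ... | false = cong (_+ℕ 0) (false⇒count≡0 {n} (λ _ → false) (λ _ → refl))
    ... | true = trans (cong (_+ℕ 𝟙 (isLoop e)) (sym (∣p∣≡count (proj e)))) (halfEdges _ (meetsU e A∋) (atMostTwo e))

    handshake : ∣ U ∣ +ℕ loops A ≡ ∣ A ∣ +ℕ ∣ A ∣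
    handshake = begin
      ∣ U ∣ +ℕ loops A
        ≡⟨ cong₂ _+ℕ_ (∣p∣≡count U) (∣tabulate∣≡count (λ e → e ∈ᵇ A ∧ isLoop e)) ⟩
      count (lookup U) +ℕ count (λ e → e ∈ᵇ A ∧ isLoop e)
        ≡⟨ cong (_+ℕ count (λ e → e ∈ᵇ A ∧ isLoop e)) (trans (sum-cong-≗ (sym ∘ tallyAtVertex)) (sym (∑-comm (λ e u → 𝟙 (covers A e u))))) ⟩
      ∑[ e < m ] count (covers A e) +ℕ count (λ e → e ∈ᵇ A ∧ isLoop e)
        ≡⟨ sym (∑-distrib-+ (λ e → count (covers A e)) (λ e → 𝟙 (e ∈ᵇ A ∧ isLoop e))) ⟩
      ∑[ e < m ] (count (covers A e) +ℕ 𝟙 (e ∈ᵇ A ∧ isLoop e))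
        ≡⟨ sum-cong-≗ tallyAtEdge ⟩
      ∑[ e < m ] (𝟙 (e ∈ᵇ A) +ℕ 𝟙 (e ∈ᵇ A))
        ≡⟨ ∑-distrib-+ (λ e → 𝟙 (e ∈ᵇ A)) (λ e → 𝟙 (e ∈ᵇ A)) ⟩
      count (lookup A) +ℕ count (lookup A)
        ≡⟨ sym (cong₂ _+ℕ_ (∣p∣≡count A) (∣p∣≡count A)) ⟩
      ∣ A ∣ +ℕ ∣ A ∣ ∎
      where open ≡-Reasoning

    matchingSize : (∣ U ∣ +ℕ loops A) / 2 ≡ ∣ A ∣
    matchingSize = trans (cong (_/ 2) handshake) (double/2 ∣ A ∣)

    loops≤∣U∣ : loops A ≤ ∣ U ∣
    loops≤∣U∣ = ℕ.≤-trans loops≤∣A∣ (ℕ.+-cancelʳ-≤ (loops A) ∣ A ∣ ∣ U ∣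
      (ℕ.≤-trans (ℕ.+-monoʳ-≤ ∣ A ∣ loops≤∣A∣) (ℕ.≤-reflexive (sym handshake))))
      where
      loops≤∣A∣ : loops A ≤ ∣ A ∣
      loops≤∣A∣ = ℕ.≤-trans (ℕ.≤-reflexive (∣tabulate∣≡count (λ e → e ∈ᵇ A ∧ isLoop e)))
        (ℕ.≤-trans (count-mono _ (lookup A) (λ _ → ∧-elimˡ)) (ℕ.≤-reflexive (sym (∣p∣≡count A))))

  f≡p : ∀ e → ∣ proj e ∣ ≢ 0 → f e ≡ p e
  f≡p e meets = exponents ∣ proj e ∣ meets (atMostTwo e)
    where
    exponents : ∀ x → x ≢ 0 → x ≤ 2 → (if x ≡ᵇ 2 then 2 else 1) ≡ (if x ≡ᵇ 1 then 1 else 2)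
    exponents zero x≢0 _ = ⊥-elim (x≢0 refl)
    exponents 1 _ _ = refl
    exponents 2 _ _ = refl
    exponents (suc (suc (suc x))) _ (s≤s (s≤s ()))

  f≡1 : ∀ e → ∣ proj e ∣ ≡ 0 → f e ≡ 1
  f≡1 e misses rewrite misses = refl

  DisjointOnU : Subset m → Set
  DisjointOnU S = ∀ e₁ e₂ → e₁ ∈ᵇ S ≡ true → e₂ ∈ᵇ S ≡ true → e₁ ≢ e₂ → ∣ E e₁ ∩ E e₂ ∩ U ∣ ≡ 0

  MeetU MissU : Subset m → Set
  MeetU S = ∀ e → e ∈ᵇ S ≡ true → ∣ proj e ∣ ≢ 0
  MissU S = ∀ e → e ∈ᵇ S ≡ true → ∣ proj e ∣ ≡ 0

  common∈ : ∀ e₁ e₂ u → u ∈ᵇ E e₁ ≡ true → u ∈ᵇ proj e₂ ≡ true → u ∈ᵇ (E e₁ ∩ E e₂ ∩ U) ≡ true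
  common∈ e₁ e₂ u h₁ h₂ = trans (lookup-∩ (E e₁) (E e₂ ∩ U) u) (∧-intro h₁ h₂)

  common∈⁻ : ∀ e₁ e₂ u → u ∈ᵇ (E e₁ ∩ E e₂ ∩ U) ≡ true → u ∈ᵇ E e₁ ≡ true × u ∈ᵇ proj e₂ ≡ true
  common∈⁻ e₁ e₂ u h = ∧-elim (trans (sym (lookup-∩ (E e₁) (E e₂ ∩ U) u)) h)

  -- Adding edges that miss U to a set A of edges does not change how U
  -- is covered: A ∪ B covers U with pairwise disjoint projections iff
  -- every vertex of U is covered by exactly one edge of A.
  module _ (A B : Subset m) (missB : MissU B) where

    onceCovered⇒covered : (∀ u → u ∈ᵇ U ≡ true → coverCount A u ≡ 1) →
      ∀ u → u ∈ᵇ U ≡ true → u ∈ᵇ unionOf (A ∪ B) ≡ true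
    onceCovered⇒covered once u u∈U
      with count≢0⇒witness (λ e → covers A e u) (λ c≡0 → ℕ.1+n≢0 (trans (sym (once u u∈U)) (trans (∣tabulate∣≡count (λ e → covers A e u)) c≡0)))
    ... | e , cov = unionAlong-intro E (A ∪ B) id e u (∪-introˡ A B e (∧-elimˡ cov)) (proj-inE e u (∧-elimʳ {e ∈ᵇ A} cov))

    onceCovered⇒disjoint : (∀ u → u ∈ᵇ U ≡ true → coverCount A u ≡ 1) → DisjointOnU (A ∪ B)
    onceCovered⇒disjoint once e₁ e₂ e₁∈ e₂∈ e₁≢e₂ =
      trans (∣p∣≡count (E e₁ ∩ E e₂ ∩ U))
            (false⇒count≡0 (lookup (E e₁ ∩ E e₂ ∩ U)) (λ u → ¬-not (noCommon u ∘ common∈⁻ e₁ e₂ u)))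
      where
      -- A common vertex of e₁ and e₂ in U would be covered twice by A,
      -- or covered by an edge of B.
      noCommon : ∀ u → u ∈ᵇ E e₁ ≡ true × u ∈ᵇ proj e₂ ≡ true → Empty
      noCommon u (inE₁ , inP₂) with ∪-elim A B e₁ e₁∈ | ∪-elim A B e₂ e₂∈
      ... | inj₂ e₁∈B | _ = true≢false (proj-intro e₁ u inE₁ (proj-inU e₂ u inP₂)) (proj-empty e₁ u (missB e₁ e₁∈B))
      ... | inj₁ _ | inj₂ e₂∈B = true≢false inP₂ (proj-empty e₂ u (missB e₂ e₂∈B))
      ... | inj₁ e₁∈A | inj₁ e₂∈A = ℕ.<-irrefl refl (ℕ.≤-trans
        (witnesses⇒2≤count (λ e → covers A e u) e₁ e₂ e₁≢e₂ (∧-intro e₁∈A (proj-intro e₁ u inE₁ u∈U)) (∧-intro e₂∈A inP₂))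
        (ℕ.≤-reflexive (trans (sym (∣tabulate∣≡count (λ e → covers A e u))) (once u u∈U))))
        where u∈U = proj-inU e₂ u inP₂

    covered⇒onceCovered : (∀ u → u ∈ᵇ U ≡ true → u ∈ᵇ unionOf (A ∪ B) ≡ true) → DisjointOnU (A ∪ B) →
      ∀ u → u ∈ᵇ U ≡ true → coverCount A u ≡ 1
    covered⇒onceCovered covered disjoint u u∈U = ℕ.≤-antisym atMostOnce atLeastOnce
      where
      atLeastOnce : 1 ≤ coverCount A u
      atLeastOnce with unionAlong-elim E (A ∪ B) id u (covered u u∈U)
      ... | e , e∈ , u∈e with ∪-elim A B e e∈
      ...   | inj₁ e∈A = ℕ.≤-trans (witness⇒1≤count (λ e → covers A e u) e (∧-intro e∈A (proj-intro e u u∈e u∈U)))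
                                   (ℕ.≤-reflexive (sym (∣tabulate∣≡count (λ e → covers A e u))))
      ...   | inj₂ e∈B = ⊥-elim (true≢false (proj-intro e u u∈e u∈U) (proj-empty e u (missB e e∈B)))
      unique : ∀ e₁ e₂ → covers A e₁ u ≡ true → covers A e₂ u ≡ true → e₁ ≡ e₂
      unique e₁ e₂ c₁ c₂ with e₁ ≟ᶠ e₂
      ... | yes e₁≡e₂ = e₁≡e₂
      ... | no e₁≢e₂ = ⊥-elim (true≢false
        (common∈ e₁ e₂ u (proj-inE e₁ u (∧-elimʳ {e₁ ∈ᵇ A} c₁)) (∧-elimʳ {e₂ ∈ᵇ A} c₂))
        (count≡0⇒false (lookup (E e₁ ∩ E e₂ ∩ U)) (trans (sym (∣p∣≡count (E e₁ ∩ E e₂ ∩ U)))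
          (disjoint e₁ e₂ (∪-introˡ A B e₁ (∧-elimˡ c₁)) (∪-introˡ A B e₂ (∧-elimˡ c₂)) e₁≢e₂)) u))
      atMostOnce : coverCount A u ≤ 1
      atMostOnce = ℕ.≤-trans (ℕ.≤-reflexive (∣tabulate∣≡count (λ e → covers A e u))) (unique⇒count≤1 (λ e → covers A e u) unique)

  distinctᵇ-sound : ∀ (e₁ e₂ : Fin m) → not (does (e₁ ≟ᶠ e₂)) ≡ true → e₁ ≢ e₂
  distinctᵇ-sound e₁ e₂ h e₁≡e₂ with e₁ ≟ᶠ e₂
  ... | yes _ = true≢false h refl
  ... | no e₁≢e₂ = e₁≢e₂ e₁≡e₂

  distinctᵇ-complete : ∀ (e₁ e₂ : Fin m) → e₁ ≢ e₂ → not (does (e₁ ≟ᶠ e₂)) ≡ true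
  distinctᵇ-complete e₁ e₂ e₁≢e₂ with e₁ ≟ᶠ e₂
  ... | yes e₁≡e₂ = ⊥-elim (e₁≢e₂ e₁≡e₂)
  ... | no _ = refl

  meetsU? : Vec Bool m
  meetsU? = tabulate (λ e → not (∣ proj e ∣ ≡ᵇ 0))

  separated⇒meet : ∀ A B → separates meetsU? A B ≡ true → MeetU A
  separated⇒meet A B sep e e∈A =
    nonzeroᵇ-sound _ (trans (sym (lookup∘tabulate _ e)) (separates-inside meetsU? A B sep e e∈A))

  separated⇒miss : ∀ A B → separates meetsU? A B ≡ true → MissU B
  separated⇒miss A B sep e e∈B with ∣ proj e ∣ in size
  ... | zero = refl
  ... | suc _ = ⊥-elim (true≢false (trans (lookup∘tabulate _ e) (cong (λ x → not (x ≡ᵇ 0)) size))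
                                   (separates-outside meetsU? A B sep e e∈B))

  meet-miss⇒separated : ∀ A B → MeetU A → MissU B → separates meetsU? A B ≡ true
  meet-miss⇒separated A B meet miss = separates-complete meetsU? A B
    (λ e e∈A → trans (lookup∘tabulate _ e) (nonzeroᵇ-complete _ (meet e e∈A)))
    (λ e e∈B → trans (lookup∘tabulate _ e) (cong (λ x → not (x ≡ᵇ 0)) (miss e e∈B)))

  meet-miss⇒disjoint : ∀ A B → MeetU A → MissU B → ∀ e → e ∈ᵇ A ≡ true → e ∈ᵇ B ≢ true
  meet-miss⇒disjoint A B meet miss e e∈A e∈B = meet e e∈A (miss e e∈B)

  module _ (k : ℕ) .{{_ : NonZero k}} where

    record WSet (S : Subset m) : Set where
      field
        avoidsX : ∀ e → e ∈ᵇ S ≡ true → disjX e ≡ true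
        size : ∣ S ∣ ≡ n / k
        coversU : ∀ u → u ∈ᵇ U ≡ true → u ∈ᵇ unionOf S ≡ true
        disjointOnU : DisjointOnU S

    isWSet-sound : ∀ S → isWSet k S ≡ true → WSet S
    isWSet-sound S h with ∧-elim {allB (λ e → not (e ∈ᵇ S) ∨ disjX e)} h
    ... | avoid , rest with ∧-elim {∣ S ∣ ≡ᵇ n / k} rest
    ... | size , rest′ with ∧-elim {U ⊆ᵇ unionOf S} rest′
    ... | cover , disjoint = record
      { avoidsX = λ e → ⇒-elim (allB-sound _ avoid e)
      ; size = ≡ᵇ-sound size
      ; coversU = λ u → ⇒-elim (allB-sound _ cover u)
      ; disjointOnU = λ e₁ e₂ e₁∈ e₂∈ e₁≢e₂ → ≡ᵇ-sound (⇒-elim (allB-sound _ (allB-sound _ disjoint e₁) e₂)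
          (∧-intro e₁∈ (∧-intro e₂∈ (distinctᵇ-complete e₁ e₂ e₁≢e₂))))
      }

    isWSet-complete : ∀ S → WSet S → isWSet k S ≡ true
    isWSet-complete S w =
      ∧-intro (allB-complete _ (λ e → ⇒-intro (avoidsX e)))
      (∧-intro (≡ᵇ-complete size)
      (∧-intro (allB-complete _ (λ u → ⇒-intro (coversU u)))
               (allB-complete _ (λ e₁ → allB-complete _ (λ e₂ → ⇒-intro (λ pre →
                  ≡ᵇ-complete (disjointOnU e₁ e₂ (∧-elimˡ pre) (∧-elimˡ (∧-elimʳ {e₁ ∈ᵇ S} pre))
                    (distinctᵇ-sound e₁ e₂ (∧-elimʳ {e₂ ∈ᵇ S} (∧-elimʳ {e₁ ∈ᵇ S} pre))))))))))
      where open WSet w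

    record Decomposition (A B : Subset m) : Set where
      field
        matching : PerfectMatching A
        inZ-B : ∀ e → e ∈ᵇ B ≡ true → inZ e ≡ true
        sizes : ∣ A ∣ +ℕ ∣ B ∣ ≡ n / k

      missB : MissU B
      missB e e∈B = ≡ᵇ-sound (∧-elimʳ {disjX e} (inZ-B e e∈B))

    WSet⇒Decomposition : ∀ A B → separates meetsU? A B ≡ true → WSet (A ∪ B) → Decomposition A B
    WSet⇒Decomposition A B sep w = record
      { matching = record
        { avoidsX = λ e e∈A → avoidsX e (∪-introˡ A B e e∈A)
        ; meetsU = meetA
        ; coversOnce = covered⇒onceCovered A B missB coversU disjointOnU
        }
      ; inZ-B = λ e e∈B → ∧-intro (avoidsX e (∪-introʳ A B e e∈B)) (≡ᵇ-complete (missB e e∈B))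
      ; sizes = trans (sym (∣p∪q∣≡∣p∣+∣q∣ A B (meet-miss⇒disjoint A B meetA missB))) size
      }
      where
      open WSet w
      meetA : MeetU A
      meetA = separated⇒meet A B sep
      missB : MissU B
      missB = separated⇒miss A B sep

    Decomposition⇒separated : ∀ A B → Decomposition A B → separates meetsU? A B ≡ true
    Decomposition⇒separated A B d = meet-miss⇒separated A B (PerfectMatching.meetsU matching) missB
      where open Decomposition d

    Decomposition⇒WSet : ∀ A B → Decomposition A B → WSet (A ∪ B)
    Decomposition⇒WSet A B d = record
      { avoidsX = avoidsX∪
      ; size = trans (∣p∪q∣≡∣p∣+∣q∣ A B (meet-miss⇒disjoint A B meetsU missB)) sizes
      ; coversU = onceCovered⇒covered A B missB coversOnce
      ; disjointOnU = onceCovered⇒disjoint A B missB coversOnce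
      }
      where
      open Decomposition d
      open PerfectMatching matching
      avoidsX∪ : ∀ e → e ∈ᵇ (A ∪ B) ≡ true → disjX e ≡ true
      avoidsX∪ e e∈ with ∪-elim A B e e∈
      ... | inj₁ e∈A = avoidsX e e∈A
      ... | inj₂ e∈B = ∧-elimˡ (inZ-B e e∈B)

    half : ℕ → ℕ
    half i = (∣ U ∣ +ℕ i) / 2

    -- The conditions under which (A , B) contributes to the i-th term
    -- Z(|V|/k − ⌊(|U|+i)/2⌋) · M_i of the right-hand side …
    rhsCondition : ℕ → Subset m → Subset m → Bool
    rhsCondition i A B =
      ((half i ≤ᵇ n / k) ∧ (allB (λ e → not (e ∈ᵇ B) ∨ inZ e) ∧ (∣ B ∣ ≡ᵇ n / k ∸ half i)))
      ∧ (isPM A ∧ (loops A ≡ᵇ i))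

    -- … which can only happen for i = loops A, in the range i ≤ |U|.
    admissible : Subset m → Subset m → Bool
    admissible A B = (loops A <ᵇ suc ∣ U ∣) ∧ rhsCondition (loops A) A B

    admissible-sound : ∀ A B → admissible A B ≡ true → Decomposition A B
    admissible-sound A B h = record
      { matching = pm
      ; inZ-B = λ e → ⇒-elim (allB-sound _ (∧-elimˡ zCond) e)
      ; sizes = trans (cong (∣ A ∣ +ℕ_) ∣B∣≡) (ℕ.m+[n∸m]≡n ∣A∣≤)
      }
      where
      cond : rhsCondition (loops A) A B ≡ true
      cond = ∧-elimʳ {loops A <ᵇ suc ∣ U ∣} h
      zCond : allB (λ e → not (e ∈ᵇ B) ∨ inZ e) ∧ (∣ B ∣ ≡ᵇ n / k ∸ half (loops A)) ≡ true
      zCond = ∧-elimʳ {half (loops A) ≤ᵇ n / k} (∧-elimˡ cond)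
      pm : PerfectMatching A
      pm = isPM-sound A (∧-elimˡ (∧-elimʳ {(half (loops A) ≤ᵇ n / k) ∧ _} cond))
      ∣A∣≤ : ∣ A ∣ ≤ n / k
      ∣A∣≤ = subst (_≤ n / k) (matchingSize pm) (≤ᵇ-sound (∧-elimˡ (∧-elimˡ cond)))
      ∣B∣≡ : ∣ B ∣ ≡ n / k ∸ ∣ A ∣
      ∣B∣≡ = trans (≡ᵇ-sound (∧-elimʳ {allB (λ e → not (e ∈ᵇ B) ∨ inZ e)} zCond)) (cong (n / k ∸_) (matchingSize pm))

    admissible-complete : ∀ A B → Decomposition A B → admissible A B ≡ true
    admissible-complete A B d = ∧-intro (<ᵇ-complete (s≤s (loops≤∣U∣ matching)))
      (∧-intro (∧-intro (≤ᵇ-complete half≤) (∧-intro (allB-complete _ (λ e → ⇒-intro (inZ-B e))) (≡ᵇ-complete ∣B∣≡)))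
               (∧-intro (isPM-complete A matching) (≡ᵇ-complete {loops A} refl)))
      where
      open Decomposition d
      half≤ : half (loops A) ≤ n / k
      half≤ = subst (_≤ n / k) (sym (matchingSize matching)) (subst (∣ A ∣ ≤_) sizes (ℕ.m≤m+n ∣ A ∣ ∣ B ∣))
      ∣B∣≡ : ∣ B ∣ ≡ n / k ∸ half (loops A)
      ∣B∣≡ = begin
        ∣ B ∣                        ≡⟨ sym (ℕ.m+n∸m≡n ∣ A ∣ ∣ B ∣) ⟩
        (∣ A ∣ +ℕ ∣ B ∣) ∸ ∣ A ∣      ≡⟨ cong₂ _∸_ sizes (sym (matchingSize matching)) ⟩
        n / k ∸ half (loops A)       ∎
        where open ≡-Reasoning

    decomposition : ∀ A B → (separates meetsU? A B ∧ isWSet k (A ∪ B)) ≡ admissible A B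
    decomposition A B = bool-ext
      (λ h → admissible-complete A B (WSet⇒Decomposition A B (∧-elimˡ h) (isWSet-sound (A ∪ B) (∧-elimʳ {separates meetsU? A B} h))))
      (λ h → let d = admissible-sound A B h in
             ∧-intro (Decomposition⇒separated A B d) (isWSet-complete (A ∪ B) (Decomposition⇒WSet A B d)))

module Identity {c ℓ : Level} (R : CommutativeRing c ℓ) {n m : ℕ} (k : ℕ) .{{_ : NonZero k}}
  (E : Fin m → Subset n) (U X : Subset n) (atMostTwo : ∀ e → ∣ E e ∩ U ∣ ≤ 2)
  (v : Fin m → CommutativeRing.Carrier R) where
  open CommutativeRing R renaming (refl to ≈-refl; sym to ≈-sym; trans to ≈-trans) hiding (zero)
  open RingSums R
  open Hyper E U X
  open Poly R v
  open ProjectedHypergraph E U X atMostTwo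

  Σ : (Subset m → Carrier) → Carrier
  Σ = sumOver (allSubsets m)

  wW wM wZ : Subset m → Carrier
  wW S = prodOn S (λ e → pow (v e) (f e))
  wM A = prodOn A (λ e → pow (v e) (p e))
  wZ B = prodOn B v

  weight : ∀ A B → Decomposition k A B → wW (A ∪ B) ≈ wZ B * wM A
  weight A B d = ≈-trans (prodAlong-∪ A B _ id (meet-miss⇒disjoint A B meetsU missB))
    (≈-trans (*-cong (prodAlong-cong A _ _ id (λ e e∈A → reflexive (cong (pow (v e)) (f≡p e (meetsU e e∈A)))))
                     (prodAlong-cong B _ _ id (λ e e∈B → ≈-trans (reflexive (cong (pow (v e)) (f≡1 e (missB e e∈B))))
                                                                  (*-identityʳ (v e)))))
             (*-comm _ _))
    where
    open Decomposition d
    open PerfectMatching matching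

  term : ℕ → Subset m → Subset m → Carrier
  term i A B = Zterm-summand * Mpoly-summand
    where
    Zterm-summand Mpoly-summand : Carrier
    Zterm-summand = if half k i ≤ᵇ n / k then (if allB (λ e → not (e ∈ᵇ B) ∨ inZ e) ∧ (∣ B ∣ ≡ᵇ n / k ∸ half k i) then wZ B else 0#) else 0#
    Mpoly-summand = if isPM A ∧ (loops A ≡ᵇ i) then wM A else 0#

  term-collapse : ∀ A B → sumOver (upTo (suc ∣ U ∣)) (λ i → term i A B) ≈ (if admissible k A B then wZ B * wM A else 0#)
  term-collapse A B = ≈-trans (sumOver-applyUpTo-single (suc ∣ U ∣) id (λ i → term i A B) (loops A) offTerm) onTerm
    where
    offTerm : ∀ i → i ≢ loops A → term i A B ≈ 0#
    offTerm i i≢ rewrite ≡ᵇ-false {loops A} {i} (i≢ ∘ sym) | ∧-zeroʳ (isPM A) = zeroʳ _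
    onTerm : (if loops A <ᵇ suc ∣ U ∣ then term (loops A) A B else 0#) ≈ (if admissible k A B then wZ B * wM A else 0#)
    onTerm with loops A <ᵇ suc ∣ U ∣
    ... | true = if-*-if (half k (loops A) ≤ᵇ n / k)
                         (allB (λ e → not (e ∈ᵇ B) ∨ inZ e) ∧ (∣ B ∣ ≡ᵇ n / k ∸ half k (loops A)))
                         (isPM A ∧ (loops A ≡ᵇ loops A)) (wZ B) (wM A)
    ... | false = ≈-refl

  lhs-pairs : W2f k ≈ Σ (λ B → Σ (λ A → if separates meetsU? A B ∧ isWSet k (A ∪ B) then wW (A ∪ B) else 0#))
  lhs-pairs = ≈-trans (sum-separated meetsU? (λ S → if isWSet k S then wW S else 0#))
    (≈-trans (sumOver-swap (allSubsets m) (allSubsets m) _)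
             (sumOver-cong (allSubsets m) (λ B → sumOver-cong (allSubsets m) (λ A →
               reflexive (if-nest (separates meetsU? A B) _ _)))))

  rhs-pairs : RHS k ≈ Σ (λ B → Σ (λ A → sumOver (upTo (suc ∣ U ∣)) (λ i → term i A B)))
  rhs-pairs = ≈-trans (sumOver-cong (upTo (suc ∣ U ∣)) (λ i →
      ≈-trans (*-congʳ (if-sumOver (half k i ≤ᵇ n / k) (allSubsets m) _)) (sumOver-*-sumOver (allSubsets m) (allSubsets m) _ _)))
    (≈-trans (sumOver-swap (upTo (suc ∣ U ∣)) (allSubsets m) _)
             (sumOver-cong (allSubsets m) (λ B → sumOver-swap (upTo (suc ∣ U ∣)) (allSubsets m) _)))

  pair-term : ∀ A B → (if separates meetsU? A B ∧ isWSet k (A ∪ B) then wW (A ∪ B) else 0#)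
                      ≈ sumOver (upTo (suc ∣ U ∣)) (λ i → term i A B)
  pair-term A B rewrite decomposition k A B = ≈-trans guarded (≈-sym (term-collapse A B))
    where
    guarded : (if admissible k A B then wW (A ∪ B) else 0#) ≈ (if admissible k A B then wZ B * wM A else 0#)
    guarded with admissible k A B in adm
    ... | true = weight A B (admissible-sound k A B adm)
    ... | false = ≈-refl

  identity : W2f k ≈ RHS k
  identity = ≈-trans lhs-pairs (≈-trans
    (sumOver-cong (allSubsets m) (λ B → sumOver-cong (allSubsets m) (λ A → pair-term A B)))
    (≈-sym rhs-pairs))

-- Lemma 4.3.
lemma4p3 : {c ℓ : Level} (R : CommutativeRing c ℓ)
    → CommutativeRing._≈_ R (CommutativeRing._+_ R (CommutativeRing.1# R) (CommutativeRing.1# R)) (CommutativeRing.0# R)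
    → (n m k : ℕ) .{{_ : NonZero k}} (E : Fin m → Subset n) (U X : Subset n)
    → (∀ e → ∣ E e ∣ ≡ k)
    → (∀ e → ∣ E e ∩ U ∣ ≤ 2)
    → X ⊆ ∁ U
    → (v : Fin m → CommutativeRing.Carrier R)
    → CommutativeRing._≈_ R (Hyper.Poly.W2f E U X R v k) (Hyper.Poly.RHS E U X R v k)
lemma4p3 R _ n m k E U X _ atMostTwo _ v = Identity.identity R k E U X atMostTwo v
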